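{- Let $P:=(\iota\Rightarrow\iota)\Rightarrow\iota$. For every closed System T term $t$ of type $P$ and every sequence $\alpha:\mathbb{N}\to\mathbb{N}$, we have $[\![t]\!]\,\alpha=[\![\mathsf{dial}^T\,(\mathsf{dialogueTree}_{P}(t))]\!]\,\alpha$.
   Context: Metatheory: constructive Martin-Löf type theory without function extensionality; "$=$" is the identity type; $\mathsf{Natrec}\,f\,x\,0=x$, $\mathsf{Natrec}\,f\,x\,(n+1)=f\,n\,(\mathsf{Natrec}\,f\,x\,n)$. System T: types generated by base type $\iota$ and $\sigma\Rightarrow\tau$; terms in a context of distinct typed variables: variables, $\mathsf{zero}:\iota$, $\mathsf{succ}\,t:\iota$ ($t:\iota$), $\mathsf{rec}_\sigma\,t\,p\,q:\sigma$ ($t:\iota\Rightarrow\sigma\Rightarrow\sigma$, $p:\sigma$, $q:\iota$), $\lambda$-abstraction and application. Closed = empty context. Set interpretation: $[\![\iota]\!]=\mathbb{N}$, $[\![\sigma\Rightarrow\tau]\!]=[\![\sigma]\!]\to[\![\tau]\!]$, with $[\![x]\!]\gamma=\gamma(x)$, $[\![\mathsf{zero}]\!]=0$, $[\![\mathsf{succ}\,t]\!]\gamma=[\![t]\!]\gamma+1$, $[\![\mathsf{rec}_\sigma t_1t_2t_3]\!]\gamma=\mathsf{Natrec}([\![t_1]\!]\gamma)([\![t_2]\!]\gamma)([\![t_3]\!]\gamma)$, and standard clauses for $\lambda$ and application; $[\![t]\!]$ for closed $t$. Internal Church-encoded dialogue trees: for System T types $A,\sigma$, let $\mathsf{ChD}_A(\sigma):=(\sigma\Rightarrow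 A)\Rightarrow((\iota\Rightarrow A)\Rightarrow\iota\Rightarrow A)\Rightarrow A$. Closed terms: $\eta_A:=\lambda z\,e\,b.\,e\,z$; $\beta_A:=\lambda\varphi\,x\,e\,b.\,b\,(\lambda y.\varphi\,y\,e\,b)\,x$; $K_A:=\lambda f\,d\,e'\,b'.\,d\,(\lambda x.f\,x\,e'\,b')\,b'$ of type $(\iota\Rightarrow\mathsf{ChD}_A(\iota))\Rightarrow\mathsf{ChD}_A(\iota)\Rightarrow\mathsf{ChD}_A(\iota)$; $\mathsf{map}_A:=\lambda f.K_A(\lambda x.\eta_A(f\,x))$. Type translation: $\lceil\iota\rceil_A=\mathsf{ChD}_A(\iota)$, $\lceil\sigma\Rightarrow\tau\rceil_A=\lceil\sigma\rceil_A\Rightarrow\lceil\tau\rceil_A$, contexts pointwise. Generalised internal Kleisli extension (closed terms of type $(\iota\Rightarrow\lceil\sigma\rceil_A)\Rightarrow\mathsf{ChD}_A(\iota)\Rightarrow\lceil\sigma\rceil_A$): $\mathsf{ext}^T_{\iota,A}:=K_A$, $\mathsf{ext}^T_{\sigma_1\Rightarrow\sigma_2,A}:=\lambda f\,d\,s.\,\mathsf{ext}^T_{\sigma_2,A}(\lambda x.f\,x\,s)\,d$. Term translation: $\lceil x\rceil_A=x$, $\lceil\mathsf{zero}\rceil_A=\eta_A\,\mathsf{zero}$, $\lceil\mathsf{succ}\,t\rceil_A=\mathsf{map}_A\,(\lambda n.\mathsf{succ}\,n)\,\lceil t\rceil_A$, $\lceil\mathsf{rec}_\sigma\,t_1\,t_2\,t_3\rceil_A=\mathsf{ext}^T_{\sigma,A}\,(\lambda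 n.\mathsf{rec}_{\lceil\sigma\rceil_A}(\lambda x.\lceil t_1\rceil_A(\eta_A\,x))\,\lceil t_2\rceil_A\,n)\,\lceil t_3\rceil_A$, $\lceil\lambda x.t\rceil_A=\lambda x.\lceil t\rceil_A$, $\lceil t\,p\rceil_A=\lceil t\rceil_A\lceil p\rceil_A$. Internal generic sequence: $\mathsf{generic}_A:=K_A(\lambda i.\beta_A\,\eta_A\,i)$. For closed $t:(\iota\Rightarrow\iota)\Rightarrow\iota$, $\mathsf{dialogueTree}_A(t):=\lceil t\rceil_A\,\mathsf{generic}_A$, a closed term of type $\mathsf{ChD}_A(\iota)$. Internal dialogue operator: $\mathsf{dial}^T:=\lambda d.\,d\,(\lambda z\,w.\,z)\,(\lambda\varphi\,x\,\alpha.\,\varphi\,(\alpha\,x)\,\alpha)$, a closed term of type $\mathsf{ChD}_{P}(\iota)\Rightarrow P$ where $P=(\iota\Rightarrow\iota)\Rightarrow\iota$. -}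

module Defs where

open import Data.Nat using (ℕ; zero; suc)
open import Data.List using (List; []; _∷_)

infixr 5 _⇒_
data Ty : Set where
  ι   : Ty
  _⇒_ : Ty → Ty → Ty

Cxt : Set
Cxt = List Ty

data _∈_ : Ty → Cxt → Set where
  here  : ∀ {σ Γ} → σ ∈ (σ ∷ Γ)
  there : ∀ {σ τ Γ} → σ ∈ Γ → σ ∈ (τ ∷ Γ)

data Tm (Γ : Cxt) : Ty → Set where
  var  : ∀ {σ} → σ ∈ Γ → Tm Γ σ
  Zero : Tm Γ ι
  Succ : Tm Γ ι → Tm Γ ι
  Rec  : ∀ {σ} → Tm Γ (ι ⇒ σ ⇒ σ) → Tm Γ σ → Tm Γ ι → Tm Γ σ
  lam  : ∀ {σ τ} → Tm (σ ∷ Γ) τ → Tm Γ (σ ⇒ τ)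
  app  : ∀ {σ τ} → Tm Γ (σ ⇒ τ) → Tm Γ σ → Tm Γ τ

Closed : Ty → Set
Closed σ = Tm [] σ

Natrec : {X : Set} → (ℕ → X → X) → X → ℕ → X
Natrec f x zero    = x
Natrec f x (suc n) = f n (Natrec f x n)

⟦_⟧ty : Ty → Set
⟦ ι ⟧ty     = ℕ
⟦ σ ⇒ τ ⟧ty = ⟦ σ ⟧ty → ⟦ τ ⟧ty

data Env : Cxt → Set where
  []  : Env []
  _∷_ : ∀ {σ Γ} → ⟦ σ ⟧ty → Env Γ → Env (σ ∷ Γ)

lookupEnv : ∀ {Γ σ} → Env Γ → σ ∈ Γ → ⟦ σ ⟧ty
lookupEnv (x ∷ γ) here      = x
lookupEnv (x ∷ γ) (there i) = lookupEnv γ i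

⟦_⟧ₑ : ∀ {Γ σ} → Tm Γ σ → Env Γ → ⟦ σ ⟧ty
⟦ var i ⟧ₑ γ       = lookupEnv γ i
⟦ Zero ⟧ₑ γ        = 0
⟦ Succ t ⟧ₑ γ      = suc (⟦ t ⟧ₑ γ)
⟦ Rec t₁ t₂ t₃ ⟧ₑ γ = Natrec (⟦ t₁ ⟧ₑ γ) (⟦ t₂ ⟧ₑ γ) (⟦ t₃ ⟧ₑ γ)
⟦ lam t ⟧ₑ γ       = λ x → ⟦ t ⟧ₑ (x ∷ γ)
⟦ app t u ⟧ₑ γ     = ⟦ t ⟧ₑ γ (⟦ u ⟧ₑ γ)

⟦_⟧ : ∀ {σ} → Closed σ → ⟦ σ ⟧ty
⟦ t ⟧ = ⟦ t ⟧ₑ []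

Ren : Cxt → Cxt → Set
Ren Γ Δ = ∀ {σ} → σ ∈ Γ → σ ∈ Δ

liftRen : ∀ {Γ Δ τ} → Ren Γ Δ → Ren (τ ∷ Γ) (τ ∷ Δ)
liftRen ρ here      = here
liftRen ρ (there i) = there (ρ i)

rename : ∀ {Γ Δ σ} → Ren Γ Δ → Tm Γ σ → Tm Δ σ
rename ρ (var i)        = var (ρ i)
rename ρ Zero           = Zero
rename ρ (Succ t)       = Succ (rename ρ t)
rename ρ (Rec t₁ t₂ t₃) = Rec (rename ρ t₁) (rename ρ t₂) (rename ρ t₃)
rename ρ (lam t)        = lam (rename (liftRen ρ) t)
rename ρ (app t u)      = app (rename ρ t) (rename ρ u)

cl : ∀ {Γ σ} → Closed σ → Tm Γ σ
cl = rename (λ ())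

v0 : ∀ {Γ σ} → Tm (σ ∷ Γ) σ
v0 = var here
v1 : ∀ {Γ σ τ} → Tm (τ ∷ σ ∷ Γ) σ
v1 = var (there here)
v2 : ∀ {Γ σ τ ρ} → Tm (ρ ∷ τ ∷ σ ∷ Γ) σ
v2 = var (there (there here))
v3 : ∀ {Γ σ τ ρ κ} → Tm (κ ∷ ρ ∷ τ ∷ σ ∷ Γ) σ
v3 = var (there (there (there here)))

infixl 6 _·_
_·_ : ∀ {Γ σ τ} → Tm Γ (σ ⇒ τ) → Tm Γ σ → Tm Γ τ
_·_ = app

-- Church-encoded dialogue trees
ChD : Ty → Ty → Ty
ChD A σ = (σ ⇒ A) ⇒ ((ι ⇒ A) ⇒ ι ⇒ A) ⇒ A

-- η_A := λ z e b. e z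
η : (A : Ty) → Closed (ι ⇒ ChD A ι)
η A = lam (lam (lam (v1 · v2)))

-- β_A := λ φ x e b. b (λ y. φ y e b) x
β : (A : Ty) → Closed ((ι ⇒ ChD A ι) ⇒ ι ⇒ ChD A ι)
β A = lam (lam (lam (lam (v0 · lam (var (there (there (there (there here)))) · v0 · v2 · v1) · v2))))

-- K_A := λ f d e' b'. d (λ x. f x e' b') b'
K : (A : Ty) → Closed ((ι ⇒ ChD A ι) ⇒ ChD A ι ⇒ ChD A ι)
K A = lam (lam (lam (lam (v2 · lam (var (there (there (there (there here)))) · v0 · v2 · v1) · v0))))

-- map_A := λ f. K_A (λ x. η_A (f x))
mapT : (A : Ty) → Closed ((ι ⇒ ι) ⇒ ChD A ι ⇒ ChD A ι)
mapT A = lam (cl (K A) · lam (cl (η A) · (v1 · v0)))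

⌈_⌉ty : Ty → Ty → Ty
⌈ ι ⌉ty A     = ChD A ι
⌈ σ ⇒ τ ⌉ty A = ⌈ σ ⌉ty A ⇒ ⌈ τ ⌉ty A

⌈_⌉cx : Cxt → Ty → Cxt
⌈ [] ⌉cx A    = []
⌈ σ ∷ Γ ⌉cx A = ⌈ σ ⌉ty A ∷ ⌈ Γ ⌉cx A

⌈_⌉var : ∀ {Γ σ} → σ ∈ Γ → (A : Ty) → ⌈ σ ⌉ty A ∈ ⌈ Γ ⌉cx A
⌈ here ⌉var A    = here
⌈ there i ⌉var A = there (⌈ i ⌉var A)

extT : (σ A : Ty) → Closed ((ι ⇒ ⌈ σ ⌉ty A) ⇒ ChD A ι ⇒ ⌈ σ ⌉ty A)
extT ι A         = K A
extT (σ₁ ⇒ σ₂) A = lam (lam (lam (cl (extT σ₂ A) · lam (v3 · v0 · v1) · v1)))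

⌈_⌉ : ∀ {Γ σ} → Tm Γ σ → (A : Ty) → Tm (⌈ Γ ⌉cx A) (⌈ σ ⌉ty A)
⌈ var i ⌉ A = var (⌈ i ⌉var A)
⌈ Zero ⌉ A = cl (η A) · Zero
⌈ Succ t ⌉ A = cl (mapT A) · lam (Succ v0) · ⌈ t ⌉ A
⌈ Rec {σ = σ} t₁ t₂ t₃ ⌉ A =
  cl (extT σ A)
    · lam (Rec (lam (rename (λ i → there (there i)) (⌈ t₁ ⌉ A) · (cl (η A) · v0)))
               (rename there (⌈ t₂ ⌉ A))
               v0)
    · ⌈ t₃ ⌉ A
⌈ lam t ⌉ A = lam (⌈ t ⌉ A)
⌈ app t u ⌉ A = ⌈ t ⌉ A · ⌈ u ⌉ A

-- generic_A := K_A (λ i. β_A η_A i)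
generic : (A : Ty) → Closed (ChD A ι ⇒ ChD A ι)
generic A = cl (K A) · lam (cl (β A) · cl (η A) · v0)

P : Ty
P = (ι ⇒ ι) ⇒ ι

dialogueTree : (A : Ty) → Closed P → Closed (ChD A ι)
dialogueTree A t = ⌈ t ⌉ A · generic A

-- dial^T := λ d. d (λ z w. z) (λ φ x α. φ (α x) α)
dialT : Closed (ChD P ι ⇒ P)
dialT = lam (v0 · lam (lam v1) · lam (lam (lam (v2 · (v0 · v1) · v0))))

-- Logical relation between the direct interpretation and the Church-encoded
-- translation, for the fixed sequence α: a tree d denotes n when running d against
-- any continuation e, answering each query x by α x, gives e n α.  (Comparing at
-- α, rather than comparing functions, keeps the argument free of function
-- extensionality.)  Kleisli extension, recursion and the λ-calculus preserve the
-- relation, and the generic sequence is related to α itself; applying the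
-- fundamental lemma to t and generic with the leaf continuation λ z w → z of
-- dial gives the equation.
module Submission where

open import Defs
open import Data.Nat using (ℕ; zero; suc)
open import Data.List using ([]; _∷_)
open import Relation.Binary.PropositionalEquality using (_≡_; refl; sym; trans; cong; cong₂; subst)

cong₃ : {A B C D : Set} (f : A → B → C → D) {x x′ : A} {y y′ : B} {z z′ : C} →
        x ≡ x′ → y ≡ y′ → z ≡ z′ → f x y z ≡ f x′ y′ z′
cong₃ f refl refl refl = refl

rename-cong : ∀ {Γ Δ σ} {ρ ρ′ : Ren Γ Δ} → (∀ {τ} (i : τ ∈ Γ) → ρ i ≡ ρ′ i) →
              (t : Tm Γ σ) → rename ρ t ≡ rename ρ′ t
rename-cong h (var i)        = cong var (h i)
rename-cong h Zero           = refl
rename-cong h (Succ t)       = cong Succ (rename-cong h t)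
rename-cong h (Rec t₁ t₂ t₃) = cong₃ Rec (rename-cong h t₁) (rename-cong h t₂) (rename-cong h t₃)
rename-cong {ρ = ρ} {ρ′} h (lam t) = cong lam (rename-cong lift-h t)
  where
  lift-h : ∀ {τ} i → liftRen ρ {τ} i ≡ liftRen ρ′ i
  lift-h here      = refl
  lift-h (there i) = cong there (h i)
rename-cong h (app t u)      = cong₂ app (rename-cong h t) (rename-cong h u)

rename-∘ : ∀ {Γ Δ Θ σ} (ρ₁ : Ren Δ Θ) (ρ₂ : Ren Γ Δ) (t : Tm Γ σ) →
           rename ρ₁ (rename ρ₂ t) ≡ rename (λ i → ρ₁ (ρ₂ i)) t
rename-∘ ρ₁ ρ₂ (var i)        = refl
rename-∘ ρ₁ ρ₂ Zero           = refl
rename-∘ ρ₁ ρ₂ (Succ t)       = cong Succ (rename-∘ ρ₁ ρ₂ t)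
rename-∘ ρ₁ ρ₂ (Rec t₁ t₂ t₃) =
  cong₃ Rec (rename-∘ ρ₁ ρ₂ t₁) (rename-∘ ρ₁ ρ₂ t₂) (rename-∘ ρ₁ ρ₂ t₃)
rename-∘ ρ₁ ρ₂ (lam t)        =
  cong lam (trans (rename-∘ (liftRen ρ₁) (liftRen ρ₂) t) (rename-cong lift-∘ t))
  where
  lift-∘ : ∀ {τ} i → liftRen ρ₁ {τ} (liftRen ρ₂ i) ≡ liftRen (λ j → ρ₁ (ρ₂ j)) i
  lift-∘ here      = refl
  lift-∘ (there i) = refl
rename-∘ ρ₁ ρ₂ (app t u)      = cong₂ app (rename-∘ ρ₁ ρ₂ t) (rename-∘ ρ₁ ρ₂ u)

rename-id : ∀ {Γ σ} (t : Tm Γ σ) → rename (λ i → i) t ≡ t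
rename-id (var i)        = refl
rename-id Zero           = refl
rename-id (Succ t)       = cong Succ (rename-id t)
rename-id (Rec t₁ t₂ t₃) = cong₃ Rec (rename-id t₁) (rename-id t₂) (rename-id t₃)
rename-id (lam t)        = cong lam (trans (rename-cong lift-id t) (rename-id t))
  where
  lift-id : ∀ {τ} i → liftRen (λ j → j) {τ} i ≡ i
  lift-id here      = refl
  lift-id (there i) = refl
rename-id (app t u)      = cong₂ app (rename-id t) (rename-id u)

rename-cl : ∀ {Δ Θ σ} (ρ : Ren Δ Θ) (c : Closed σ) → rename ρ (cl c) ≡ cl c
rename-cl ρ c = trans (rename-∘ ρ (λ ()) c) (rename-cong (λ ()) c)

module Correctness (α : ℕ → ℕ) where

  branch : ⟦ (ι ⇒ P) ⇒ ι ⇒ P ⟧ty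
  branch φ x β = φ (β x) β

  Related : (σ : Ty) → ⟦ σ ⟧ty → ⟦ ⌈ σ ⌉ty P ⟧ty → Set
  Related ι       n d = ∀ e → d e branch α ≡ e n α
  Related (σ ⇒ τ) f g = ∀ x y → Related σ x y → Related τ (f x) (g y)

  η-related : ∀ n → Related ι n (⟦ η P ⟧ n)
  η-related n e = refl

  extT-related : ∀ σ {Δ} (δ : Env Δ) (g : ℕ → ⟦ σ ⟧ty) (f : ℕ → ⟦ ⌈ σ ⌉ty P ⟧ty) →
                 (∀ m → Related σ (g m) (f m)) →
                 ∀ n d → Related ι n d → Related σ (g n) (⟦ cl (extT σ P) ⟧ₑ δ f d)
  extT-related ι         δ g f gf n d nd e = trans (nd _) (gf n e)
  extT-related (σ₁ ⇒ σ₂) δ g f gf n d nd x s xs =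
    subst (λ u → Related σ₂ (g n x) (⟦ u ⟧ₑ (s ∷ d ∷ f ∷ δ) (λ m → f m s) d))
      (sym (rename-cl _ (extT σ₂ P)))
      (extT-related σ₂ (s ∷ d ∷ f ∷ δ) (λ m → g m x) (λ m → f m s)
        (λ m → gf m x s xs) n d nd)

  natrec-related : ∀ σ (f : ℕ → ⟦ σ ⟧ty → ⟦ σ ⟧ty) x
                   (F : ℕ → ⟦ ⌈ σ ⌉ty P ⟧ty → ⟦ ⌈ σ ⌉ty P ⟧ty) y →
                   (∀ j a b → Related σ a b → Related σ (f j a) (F j b)) → Related σ x y →
                   ∀ j → Related σ (Natrec f x j) (Natrec F y j)
  natrec-related σ f x F y fF xy zero    = xy
  natrec-related σ f x F y fF xy (suc j) = fF j _ _ (natrec-related σ f x F y fF xy j)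

  EnvRelated : ∀ {Γ Δ} → Ren (⌈ Γ ⌉cx P) Δ → Env Γ → Env Δ → Set
  EnvRelated {Γ} ρ γ δ = ∀ {τ} (i : τ ∈ Γ) → Related τ (lookupEnv γ i) (lookupEnv δ (ρ (⌈ i ⌉var P)))

  -- Quantifying over renamings ρ is needed because the translation of Rec weakens
  -- the translations of its arguments.
  fundamental : ∀ {Γ Δ σ} (t : Tm Γ σ) (ρ : Ren (⌈ Γ ⌉cx P) Δ) (γ : Env Γ) (δ : Env Δ) →
                EnvRelated ρ γ δ → Related σ (⟦ t ⟧ₑ γ) (⟦ rename ρ (⌈ t ⌉ P) ⟧ₑ δ)
  fundamental (var i)  ρ γ δ γδ   = γδ i
  fundamental Zero     ρ γ δ γδ e = refl
  fundamental (Succ t) ρ γ δ γδ e = fundamental t ρ γ δ γδ _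
  fundamental {Δ = Δ} (Rec {σ = σ} t₁ t₂ t₃) ρ γ δ γδ =
    subst (λ u → Related σ (⟦ Rec t₁ t₂ t₃ ⟧ₑ γ) (⟦ u ⟧ₑ δ recursor (⟦ rename ρ (⌈ t₃ ⌉ P) ⟧ₑ δ)))
      (sym (rename-cl ρ (extT σ P)))
      (extT-related σ δ (Natrec (⟦ t₁ ⟧ₑ γ) (⟦ t₂ ⟧ₑ γ)) recursor
        (λ m → natrec-related σ _ _ _ _ (step m) (base m) m)
        (⟦ t₃ ⟧ₑ γ) _ (fundamental t₃ ρ γ δ γδ))
    where
    step-term : Tm (ι ∷ ι ∷ Δ) (⌈ ι ⇒ σ ⇒ σ ⌉ty P)
    step-term = rename (liftRen (liftRen ρ)) (rename (λ i → there (there i)) (⌈ t₁ ⌉ P))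
    base-term : Tm (ι ∷ Δ) (⌈ σ ⌉ty P)
    base-term = rename (liftRen ρ) (rename there (⌈ t₂ ⌉ P))
    recursor : ℕ → ⟦ ⌈ σ ⌉ty P ⟧ty
    recursor m = Natrec (λ j → ⟦ step-term ⟧ₑ (j ∷ m ∷ δ) (λ e _ → e j)) (⟦ base-term ⟧ₑ (m ∷ δ)) m
    step : ∀ m j a b → Related σ a b →
           Related σ (⟦ t₁ ⟧ₑ γ j a) (⟦ step-term ⟧ₑ (j ∷ m ∷ δ) (λ e _ → e j) b)
    step m j = subst (λ u → Related (ι ⇒ σ ⇒ σ) (⟦ t₁ ⟧ₑ γ) (⟦ u ⟧ₑ (j ∷ m ∷ δ)))
      (sym (rename-∘ (liftRen (liftRen ρ)) (λ i → there (there i)) (⌈ t₁ ⌉ P)))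
      (fundamental t₁ _ γ (j ∷ m ∷ δ) γδ) j _ (η-related j)
    base : ∀ m → Related σ (⟦ t₂ ⟧ₑ γ) (⟦ base-term ⟧ₑ (m ∷ δ))
    base m = subst (λ u → Related σ (⟦ t₂ ⟧ₑ γ) (⟦ u ⟧ₑ (m ∷ δ)))
      (sym (rename-∘ (liftRen ρ) there (⌈ t₂ ⌉ P)))
      (fundamental t₂ _ γ (m ∷ δ) γδ)
  fundamental (lam t)   ρ γ δ γδ x y xy = fundamental t (liftRen ρ) (x ∷ γ) (y ∷ δ) xyγδ
    where
    xyγδ : EnvRelated (liftRen ρ) (x ∷ γ) (y ∷ δ)
    xyγδ here      = xy
    xyγδ (there i) = γδ i
  fundamental (app t u) ρ γ δ γδ = fundamental t ρ γ δ γδ _ _ (fundamental u ρ γ δ γδ)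

  generic-related : Related (ι ⇒ ι) α (⟦ generic P ⟧)
  generic-related n d nd e = nd _

  closed-related : ∀ {σ} (t : Closed σ) → Related σ ⟦ t ⟧ ⟦ ⌈ t ⌉ P ⟧
  closed-related {σ} t = subst (λ u → Related σ ⟦ t ⟧ ⟦ u ⟧) (rename-id (⌈ t ⌉ P))
    (fundamental t (λ i → i) [] [] (λ ()))

theorem37 : (t : Closed P) (α : ℕ → ℕ) →
    ⟦ t ⟧ α ≡ ⟦ app dialT (dialogueTree P t) ⟧ α
theorem37 t α =
  sym (closed-related t α (⟦ generic P ⟧) generic-related (λ z w → z))
  where open Correctness α
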